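{- Let $(a_k)_{k\ge1}$ and $(b_k)_{k\ge1}$ be sequences of complex numbers such that, for some $p$ with $\Re(p)>1$, $a_k=o(k^{ -p})$ and $b_k=o(k^{ -p})$ as $k\to\infty$. Put $A_n=\sum_{k=1}^n a_k$, $B_n=\sum_{k=1}^n b_k$, $A=\lim_{n\to\infty}A_n$, $B=\lim_{n\to\infty}B_n$, and for $x\in[-1,1]$ let $F_n(A,B;x)=\sum_{k=1}^n (A-A_k)(B-B_k)x^k$. Then for every $x\in[-1,1]$ and every positive integer $n$, \begin{align*} (1-x)F_n(A,B;x) ={}& ABx-(A-A_n)(B-B_n)x^{n+1}-\Big(\sum_{k=1}^n a_kx^k\Big)(B-B_n)-\Big(\sum_{k=1}^n b_kx^k\Big)(A-A_n)\\ &-\sum_{k=1}^n\Big(\sum_{i=1}^k a_ix^i\Big)b_k-\sum_{k=1}^n\Big(\sum_{i=1}^k b_ix^i\Big)a_k+\sum_{k=1}^n a_kb_kx^k . \end{align*}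
   Context: $A$ and $B$ are the sums of the convergent series $\sum a_k$ and $\sum b_k$, and $A_n,B_n$ their partial sums. -}

module Defs where

open import Algebra.Bundles using (CommutativeRing)
open import Data.Nat using (ℕ; zero; suc)

-- All notions are stated over an arbitrary commutative ring R
-- (the paper's case is R = ℂ).
module _ {c ℓ} (R : CommutativeRing c ℓ) where
  open CommutativeRing R

  sub : Carrier → Carrier → Carrier
  sub u v = u + (- v)

  pow : Carrier → ℕ → Carrier
  pow x zero = 1#
  pow x (suc k) = pow x k * x

  -- Σ_{k=1}^{n} f k   (sequences are indexed from 1; f 0 is never used)
  sum1 : (ℕ → Carrier) → ℕ → Carrier
  sum1 f zero = 0#
  sum1 f (suc n) = sum1 f n + f (suc n)

  Fn : (a b : ℕ → Carrier) (A B x : Carrier) → ℕ → Carrier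
  Fn a b A B x n =
    sum1 (λ k → (sub A (sum1 a k) * sub B (sum1 b k)) * pow x k) n

-- Both sides vanish at n = 0, and the
-- right-hand side grows from n to n + 1 by exactly (1 − x) times the new summand
-- α β xⁿ⁺¹ of Fₙ₊₁, where α = A − Aₙ₊₁ and β = B − Bₙ₊₁: writing a, b for aₙ₊₁,
-- bₙ₊₁, the increment collapses to xⁿ⁺¹ ((α + a)(β + b) − aβ − bα − ab) − xⁿ⁺² αβ.
-- No convergence is used, so the identity holds for arbitrary sequences in any
-- commutative ring.
module Submission where

open import Defs
open import Algebra.Bundles using (CommutativeRing)
open import Algebra.Solver.Ring.AlmostCommutativeRing
  using (fromCommutativeRing; _-Raw-AlmostCommutative⟶_)
open import Data.Integer.Base as ℤ using (ℤ; +_; -[1+_]; _⊖_; +-*-rawRing)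
open import Data.Integer.Properties
  using ([1+m]⊖[1+n]≡m⊖n; pos-*; neg-distribˡ-*; neg-distribʳ-*; _≟_)
import Data.Maybe as Maybe
open import Data.Nat.Base as ℕ using (ℕ; zero; suc; _≤_)
open import Data.Nat.Properties using (+-suc)
open import Relation.Binary.PropositionalEquality using (cong)
open import Relation.Binary.Consequences using (dec⇒weaklyDec)
import Algebra.Properties.AbelianGroup as AbelianGroupProperties
import Algebra.Properties.Ring as RingProperties
import Algebra.Properties.Semiring.Mult.TCOptimised as SemiringMultiplication
import Algebra.Solver.Ring as RingSolver
import Relation.Binary.Reasoning.Setoid as SetoidReasoning

module _ {c ℓ} (R : CommutativeRing c ℓ) where
  open CommutativeRing R
  open AbelianGroupProperties +-abelianGroup using (⁻¹-∙-comm)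
  open RingProperties ring using (-0#≈0#; -‿involutive; -‿distribˡ-*; -‿distribʳ-*)
  open SemiringMultiplication semiring using (_×_; 1+×; ×-homo-+; ×1-homo-*)
  open SetoidReasoning setoid

  -‿cancelˡ-+ : ∀ z u v → (z + u) - (z + v) ≈ u - v
  -‿cancelˡ-+ z u v = begin
    (z + u) + - (z + v)      ≈⟨ +-cong (+-comm z u) (sym (⁻¹-∙-comm z v)) ⟩
    (u + z) + (- z + - v)    ≈⟨ +-assoc u z _ ⟩
    u + (z + (- z + - v))    ≈⟨ +-congˡ (sym (+-assoc z (- z) (- v))) ⟩
    u + ((z + - z) + - v)    ≈⟨ +-congˡ (+-congʳ (-‿inverseʳ z)) ⟩
    u + (0# + - v)           ≈⟨ +-congˡ (+-identityˡ (- v)) ⟩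
    u + - v                  ∎

  -- The ring solver needs coefficients with decidable equality in order to
  -- cancel terms, so it runs over ℤ and interprets through fromℤ.
  fromℤ : ℤ → Carrier
  fromℤ (+ n)    = n × 1#
  fromℤ -[1+ n ] = - (suc n × 1#)

  fromℤ-neg : ∀ i → fromℤ (ℤ.- i) ≈ - fromℤ i
  fromℤ-neg (+ zero)  = sym -0#≈0#
  fromℤ-neg (+ suc n) = refl
  fromℤ-neg -[1+ n ]  = sym (-‿involutive _)

  fromℤ-⊖ : ∀ m n → fromℤ (m ⊖ n) ≈ m × 1# - n × 1#
  fromℤ-⊖ zero    zero    = sym (trans (+-identityˡ _) -0#≈0#)
  fromℤ-⊖ zero    (suc n) = sym (+-identityˡ _)
  fromℤ-⊖ (suc m) zero    = sym (trans (+-congˡ -0#≈0#) (+-identityʳ _))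
  fromℤ-⊖ (suc m) (suc n) = begin
    fromℤ (suc m ⊖ suc n)     ≡⟨ cong fromℤ ([1+m]⊖[1+n]≡m⊖n m n) ⟩
    fromℤ (m ⊖ n)             ≈⟨ fromℤ-⊖ m n ⟩
    m × 1# - n × 1#                   ≈⟨ -‿cancelˡ-+ 1# _ _ ⟨
    (1# + m × 1#) - (1# + n × 1#)     ≈⟨ +-cong (1+× m 1#) (-‿cong (1+× n 1#)) ⟨
    suc m × 1# - suc n × 1#           ∎

  fromℤ-+ : ∀ i j → fromℤ (i ℤ.+ j) ≈ fromℤ i + fromℤ j
  fromℤ-+ (+ m)    (+ n)    = ×-homo-+ 1# m n
  fromℤ-+ (+ m)    -[1+ n ] = fromℤ-⊖ m (suc n)
  fromℤ-+ -[1+ m ] (+ n)    = trans (fromℤ-⊖ n (suc m)) (+-comm _ _)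
  fromℤ-+ -[1+ m ] -[1+ n ] = begin
    - (suc (suc (m ℕ.+ n)) × 1#)        ≡⟨ cong (λ k → - (suc k × 1#)) (+-suc m n) ⟨
    - ((suc m ℕ.+ suc n) × 1#)          ≈⟨ -‿cong (×-homo-+ 1# (suc m) (suc n)) ⟩
    - (suc m × 1# + suc n × 1#)         ≈⟨ ⁻¹-∙-comm _ _ ⟨
    - (suc m × 1#) + - (suc n × 1#)     ∎

  fromℤ-*-+ : ∀ m j → fromℤ (+ m ℤ.* j) ≈ m × 1# * fromℤ j
  fromℤ-*-+ m (+ n) = begin
    fromℤ (+ m ℤ.* + n)         ≡⟨ cong fromℤ (pos-* m n) ⟨
    (m ℕ.* n) × 1#              ≈⟨ ×1-homo-* m n ⟩
    m × 1# * n × 1#             ∎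
  fromℤ-*-+ m -[1+ n ] = begin
    fromℤ (+ m ℤ.* -[1+ n ])        ≡⟨ cong fromℤ (neg-distribʳ-* (+ m) (+ suc n)) ⟨
    fromℤ (ℤ.- (+ m ℤ.* + suc n))   ≈⟨ fromℤ-neg (+ m ℤ.* + suc n) ⟩
    - fromℤ (+ m ℤ.* + suc n)       ≈⟨ -‿cong (fromℤ-*-+ m (+ suc n)) ⟩
    - (m × 1# * suc n × 1#)         ≈⟨ -‿distribʳ-* _ _ ⟩
    m × 1# * - (suc n × 1#)         ∎

  fromℤ-* : ∀ i j → fromℤ (i ℤ.* j) ≈ fromℤ i * fromℤ j
  fromℤ-* (+ m)    j = fromℤ-*-+ m j
  fromℤ-* -[1+ m ] j = begin
    fromℤ (-[1+ m ] ℤ.* j)          ≡⟨ cong fromℤ (neg-distribˡ-* (+ suc m) j) ⟨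
    fromℤ (ℤ.- (+ suc m ℤ.* j))     ≈⟨ fromℤ-neg (+ suc m ℤ.* j) ⟩
    - fromℤ (+ suc m ℤ.* j)         ≈⟨ -‿cong (fromℤ-*-+ (suc m) j) ⟩
    - (suc m × 1# * fromℤ j)        ≈⟨ -‿distribˡ-* _ _ ⟩
    - (suc m × 1#) * fromℤ j        ∎

  fromℤ-homomorphism : +-*-rawRing -Raw-AlmostCommutative⟶ fromCommutativeRing R
  fromℤ-homomorphism = record
    { ⟦_⟧    = fromℤ
    ; +-homo = fromℤ-+
    ; *-homo = fromℤ-*
    ; -‿homo = fromℤ-neg
    ; 0-homo = refl
    ; 1-homo = refl
    }

  open RingSolver +-*-rawRing (fromCommutativeRing R) fromℤ-homomorphism
    (λ i j → Maybe.map (λ i≡j → reflexive (cong fromℤ i≡j)) (dec⇒weaklyDec _≟_ i j))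

  *-distribˡ-sum1 : ∀ u (f : ℕ → Carrier) n →
                    u * sum1 R f n ≈ sum1 R (λ k → u * f k) n
  *-distribˡ-sum1 u f zero    = zeroʳ u
  *-distribˡ-sum1 u f (suc n) = begin
    u * (sum1 R f n + f (suc n))               ≈⟨ distribˡ u _ _ ⟩
    u * sum1 R f n + u * f (suc n)             ≈⟨ +-congʳ (*-distribˡ-sum1 u f n) ⟩
    sum1 R (λ k → u * f k) n + u * f (suc n)   ∎

  sum1-increments : ∀ (f g : ℕ → Carrier) → g 0 ≈ 0# →
                    (∀ n → g (suc n) ≈ g n + f (suc n)) →
                    ∀ n → sum1 R f n ≈ g n
  sum1-increments f g g0≈0 step zero    = sym g0≈0
  sum1-increments f g g0≈0 step (suc n) = begin
    sum1 R f n + f (suc n)   ≈⟨ +-congʳ (sum1-increments f g g0≈0 step n) ⟩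
    g n + f (suc n)          ≈⟨ step n ⟨
    g (suc n)                ∎

  closedFormₚ : ∀ {m} (A B x Aₙ Bₙ Sa Sb Ta Tb U X : Polynomial m) → Polynomial m
  closedFormₚ A B x Aₙ Bₙ Sa Sb Ta Tb U X =
    (A :* B) :* x :- ((A :- Aₙ) :* (B :- Bₙ)) :* X :- Sa :* (B :- Bₙ)
      :- Sb :* (A :- Aₙ) :- Ta :- Tb :+ U

  module ClosedForm (a b : ℕ → Carrier) (A B x : Carrier) where

    closedForm : (Aₙ Bₙ Sa Sb Ta Tb U X : Carrier) → Carrier
    closedForm Aₙ Bₙ Sa Sb Ta Tb U X =
      (A * B) * x - ((A - Aₙ) * (B - Bₙ)) * X - Sa * (B - Bₙ) - Sb * (A - Aₙ)
        - Ta - Tb + U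

    closedForm-zero : closedForm 0# 0# 0# 0# 0# 0# 0# (pow R x 1) ≈ 0#
    closedForm-zero = solve 3
      (λ A B x → closedFormₚ A B x (con (+ 0)) (con (+ 0)) (con (+ 0)) (con (+ 0))
                   (con (+ 0)) (con (+ 0)) (con (+ 0)) (con (+ 1) :* x)
               := con (+ 0))
      refl A B x

    closedForm-suc : ∀ Aₙ Bₙ Sa Sb Ta Tb U X a′ b′ →
      closedForm (Aₙ + a′) (Bₙ + b′) (Sa + a′ * X) (Sb + b′ * X)
                 (Ta + (Sa + a′ * X) * b′) (Tb + (Sb + b′ * X) * a′)
                 (U + (a′ * b′) * X) (X * x)
        ≈ closedForm Aₙ Bₙ Sa Sb Ta Tb U X
          + (1# - x) * (((A - (Aₙ + a′)) * (B - (Bₙ + b′))) * X)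
    closedForm-suc Aₙ Bₙ Sa Sb Ta Tb U X a′ b′ = solve 13
      (λ A B x Aₙ Bₙ Sa Sb Ta Tb U X a′ b′ →
         closedFormₚ A B x (Aₙ :+ a′) (Bₙ :+ b′) (Sa :+ a′ :* X) (Sb :+ b′ :* X)
           (Ta :+ (Sa :+ a′ :* X) :* b′) (Tb :+ (Sb :+ b′ :* X) :* a′)
           (U :+ (a′ :* b′) :* X) (X :* x)
         := closedFormₚ A B x Aₙ Bₙ Sa Sb Ta Tb U X
            :+ (con (+ 1) :- x) :* (((A :- (Aₙ :+ a′)) :* (B :- (Bₙ :+ b′))) :* X))
      refl A B x Aₙ Bₙ Sa Sb Ta Tb U X a′ b′

    closedFormAt : ℕ → Carrier
    closedFormAt n =
      closedForm (sum1 R a n) (sum1 R b n)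
        (sum1 R (λ k → a k * pow R x k) n) (sum1 R (λ k → b k * pow R x k) n)
        (sum1 R (λ k → sum1 R (λ i → a i * pow R x i) k * b k) n)
        (sum1 R (λ k → sum1 R (λ i → b i * pow R x i) k * a k) n)
        (sum1 R (λ k → (a k * b k) * pow R x k) n)
        (pow R x (suc n))

    closedFormAt-suc : ∀ n → closedFormAt (suc n) ≈ closedFormAt n + (1# - x) *
      (((A - sum1 R a (suc n)) * (B - sum1 R b (suc n))) * pow R x (suc n))
    closedFormAt-suc n = closedForm-suc _ _ _ _ _ _ _ _ (a (suc n)) (b (suc n))

theorem1p1 : ∀ {c ℓ} (R : CommutativeRing c ℓ) →
    let open CommutativeRing R in
    (a b : ℕ → Carrier) (A B x : Carrier) (n : ℕ) → 1 ≤ n →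
    sub R 1# x * Fn R a b A B x n
      ≈ sub R (sub R (sub R (sub R (sub R
          ((A * B) * x)
          ((sub R A (sum1 R a n) * sub R B (sum1 R b n)) * pow R x (suc n)))
          (sum1 R (λ k → a k * pow R x k) n * sub R B (sum1 R b n)))
          (sum1 R (λ k → b k * pow R x k) n * sub R A (sum1 R a n)))
          (sum1 R (λ k → sum1 R (λ i → a i * pow R x i) k * b k) n))
          (sum1 R (λ k → sum1 R (λ i → b i * pow R x i) k * a k) n)
        + sum1 R (λ k → (a k * b k) * pow R x k) n
theorem1p1 R a b A B x n _ =
  trans (*-distribˡ-sum1 R (1# - x) _ n)
        (sum1-increments R _ closedFormAt closedForm-zero closedFormAt-suc n)
  where
  open CommutativeRing R
  open ClosedForm R a b A B x
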